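{- Let $e \geq 1$ be an odd integer and let $\omega = \sqrt[e]{2}$. Then $7 = 1 + \omega^e + \omega^{2e}$ cannot be written as $x^2 + y^2 + z^2$ with $x, y, z \in \mathbb{Z}_2[\omega]$.
   Context: $\mathbb{Z}_2[\omega]$ is the ring of integers of the totally ramified extension $\mathbb{Q}_2(\omega)$ of the $2$-adic numbers. -}

module Defs where

open import Data.Nat as ℕ using (ℕ; zero; suc)
open import Data.Fin using (Fin; toℕ; zero; suc)
open import Data.Integer as ℤ using (ℤ; +_; _-_)
open import Data.Integer.Divisibility using (_∣_)
open import Data.Bool using (if_then_else_)
open import Relation.Nullary.Decidable using (⌊_⌋)
open import Data.Product using (Σ; _×_)

sumFin : ∀ {n} → (Fin n → ℤ) → ℤ
sumFin {zero}  f = + 0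
sumFin {suc n} f = f zero ℤ.+ sumFin (λ i → f (suc i))

-- ℤ[ω] with ω^e = 2, i.e. ℤ[X]/(X^e - 2): an element is its coefficient
-- vector a₀ + a₁ ω + … + a_{e-1} ω^{e-1}.
Zω : ℕ → Set
Zω e = Fin e → ℤ

infixl 6 _+ω_
infixl 7 _*ω_

_+ω_ : ∀ {e} → Zω e → Zω e → Zω e
(a +ω b) k = a k ℤ.+ b k

-- product, reduced using ω^e = 2:
-- coefficient k = Σ_{i+j=k} aᵢbⱼ + 2 Σ_{i+j=k+e} aᵢbⱼ
_*ω_ : ∀ {e} → Zω e → Zω e → Zω e
_*ω_ {e} a b k = sumFin λ i → sumFin λ j →
  if ⌊ toℕ i ℕ.+ toℕ j ℕ.≟ toℕ k ⌋ then a i ℤ.* b j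
  else (if ⌊ toℕ i ℕ.+ toℕ j ℕ.≟ toℕ k ℕ.+ e ⌋ then + 2 ℤ.* (a i ℤ.* b j)
  else + 0)

constω : ∀ {e} → ℤ → Zω e
constω c zero    = c
constω c (suc i) = + 0

_≡ω_[mod2^_] : ∀ {e} → Zω e → Zω e → ℕ → Set
a ≡ω b [mod2^ n ] = ∀ k → (+ (2 ℕ.^ n)) ∣ (a k - b k)

-- ℤ₂[ω] = ℤ₂ ⊗ ℤ[ω] = lim_n ℤ[ω]/2^n ℤ[ω]: a compatible system of residues.
-- Two elements are equal iff they agree modulo 2^n for every n; ring
-- operations are computed levelwise.
record ℤ₂[ω] (e : ℕ) : Set where
  field
    at  : ℕ → Zω e
    coh : ∀ n → at (suc n) ≡ω at n [mod2^ n ]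
open ℤ₂[ω] public

SumOfThreeSquaresEq : ∀ {e} → ℤ₂[ω] e → ℤ₂[ω] e → ℤ₂[ω] e → ℤ → Set
SumOfThreeSquaresEq x y z c =
  ∀ n → (at x n *ω at x n +ω at y n *ω at y n +ω at z n *ω at z n)
          ≡ω constω c [mod2^ n ]

-- Write e = 2h + 1, x = Σ xₙ ωⁿ (likewise y, z), Wₙ = xₙ² + yₙ² + zₙ² and
-- Tₙ = x₀xₙ + y₀yₙ + z₀zₙ; only the equation modulo 8 is used. As ω^e = 2, the
-- coefficient of ω^k in x² is Σ_{i+j=k} xᵢxⱼ + 2 Σ_{i+j=k+e} xᵢxⱼ. Modulo 4 the
-- constant coefficient gives W₀ ≡ 3, so x₀, y₀, z₀ are odd and Tₙ ≡ Wₙ (mod 2), and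
-- the coefficient of ω^{2m}, 0 < m ≤ h, makes Wₘ even. Suppose xₙ, yₙ, zₙ are even
-- for 0 < n < L ≤ h. Then for 0 < k ≤ 2L the coefficient of ω^k is ≡ W_{k/2} + 2Tₖ
-- (mod 4) for even k and ≡ 2W_{(k+e)/2} + 2Tₖ for odd k. The odd k show inductively
-- that Wₙ is even for 0 < n ≤ 2L, and then k = 2L gives W_L ≡ 0 (mod 4), so x_L, y_L,
-- z_L are even as well. Hence xₙ, yₙ, zₙ are even for all 0 < n ≤ h, the constant
-- coefficient is ≡ W₀ (mod 8), and a sum of three squares is never 7 modulo 8.
module Submission where

open import Defs
open import Data.Integer using (+_)
open import Relation.Nullary using (¬_)

-- ℤ's operators are opened only inside this module: the statement of lemma3p12 uses ℕ's _*_.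
module _ where

  open import Algebra.Bundles using (CommutativeMonoid)
  import Algebra.Properties.CommutativeMonoid.Sum as Sum
  open import Data.Bool using (if_then_else_)
  open import Data.Empty using (⊥)
  open import Data.Fin as Fin using (Fin; zero; suc; toℕ; fromℕ<)
  open import Data.Fin.Patterns using (0F; 1F)
  import Data.Fin.Properties as Fin
  open import Data.Fin.Properties using (all?; toℕ-fromℕ<; punchInᵢ≢i; 0≢1+n)
  open import Data.Integer using (ℤ; +_; _+_; _-_; _*_; -_)
  open import Data.Integer.DivMod using (_%ℕ_; _/ℕ_; n%ℕd<d; a≡a%ℕn+[a/ℕn]*n)
  open import Data.Integer.Divisibility.Signed
    using ( _∣_; _∣?_; divides; ∣ᵤ⇒∣; ∣-trans; ∣m∣n⇒∣m+n; ∣m⇒∣-m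
          ; ∣m⇒∣m*n; ∣n⇒∣m*n; *-monoʳ-∣; *-cancelˡ-∣)
  import Data.Integer.Properties as ℤ
  open import Data.Integer.Tactic.RingSolver using (solve-∀)
  open import Data.Nat as ℕ using (ℕ; NonZero; zero; suc)
  open import Data.Nat.Induction using (<-rec)
  import Data.Nat.Properties as ℕ
  open import Data.Nat.Tactic.RingSolver renaming (solve-∀ to ℕ-solve-∀)
  open import Data.Product using (_×_; _,_; proj₁; proj₂; ∃-syntax; map)
  open import Data.Vec.Functional using (Vector; removeAt; replicate)
  open import Function using (_∘_; case_of_)
  open import Level using (0ℓ)
  open import Relation.Binary.PropositionalEquality
    using (_≡_; _≢_; refl; sym; trans; cong; cong₂; subst; subst₂; module ≡-Reasoning)
  import Relation.Binary.Reasoning.Setoid as ≈-Reasoning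
  open import Relation.Binary.Structures using (IsEquivalence)
  open import Relation.Nullary using (Dec; yes; no; ¬?; contradiction)
  open import Relation.Nullary.Decidable using (⌊_⌋; True; toWitness; map′; _×-dec_; _→-dec_)

  infix 4 _≡_[mod_]
  record _≡_[mod_] (a b : ℤ) (m : ℕ) : Set where
    constructor mod
    field divides-difference : + m ∣ a - b
  open _≡_[mod_]

  private
    negate-difference : ∀ a b → b - a ≡ - (a - b)
    negate-difference = solve-∀
    sum-difference : ∀ a b c d → (a + c) - (b + d) ≡ (a - b) + (c - d)
    sum-difference = solve-∀
    product-difference : ∀ a b c d → a * c - b * d ≡ (a - b) * c + b * (c - d)
    product-difference = solve-∀
    scaled-difference : ∀ d a b → d * a - d * b ≡ d * (a - b)
    scaled-difference = solve-∀
    multiple-difference : ∀ d a → d * a - + 0 ≡ a * d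
    multiple-difference = solve-∀
    add-subtract-cancel : ∀ r q → r + q - r ≡ q
    add-subtract-cancel = solve-∀

  module _ {m : ℕ} where

    private
      rewrite-divided : ∀ {u v} → u ≡ v → + m ∣ u → + m ∣ v
      rewrite-divided = subst (+ m ∣_)

    ≡⇒≡-mod : ∀ {a b} → a ≡ b → a ≡ b [mod m ]
    ≡⇒≡-mod {a} refl = mod (divides (+ 0) (ℤ.+-inverseʳ a))

    ≡-mod-refl : ∀ {a} → a ≡ a [mod m ]
    ≡-mod-refl = ≡⇒≡-mod refl

    ≡-mod-sym : ∀ {a b} → a ≡ b [mod m ] → b ≡ a [mod m ]
    ≡-mod-sym {a} {b} (mod p) = mod (rewrite-divided (sym (negate-difference a b)) (∣m⇒∣-m p))

    ≡-mod-trans : ∀ {a b c} → a ≡ b [mod m ] → b ≡ c [mod m ] → a ≡ c [mod m ]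
    ≡-mod-trans {a} {b} {c} (mod p) (mod q) =
      mod (rewrite-divided (ℤ.+-minus-telescope a b c) (∣m∣n⇒∣m+n p q))

    ≡-mod-isEquivalence : IsEquivalence _≡_[mod m ]
    ≡-mod-isEquivalence = record { refl = ≡-mod-refl ; sym = ≡-mod-sym ; trans = ≡-mod-trans }

    +-cong-mod : ∀ {a b c d} → a ≡ b [mod m ] → c ≡ d [mod m ] → a + c ≡ b + d [mod m ]
    +-cong-mod {a} {b} {c} {d} (mod p) (mod q) =
      mod (rewrite-divided (sym (sum-difference a b c d)) (∣m∣n⇒∣m+n p q))

    *-cong-mod : ∀ {a b c d} → a ≡ b [mod m ] → c ≡ d [mod m ] → a * c ≡ b * d [mod m ]
    *-cong-mod {a} {b} {c} {d} (mod p) (mod q) =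
      mod (rewrite-divided (sym (product-difference a b c d))
             (∣m∣n⇒∣m+n (∣m⇒∣m*n c p) (∣n⇒∣m*n b q)))

    multiple≡0-mod : ∀ a → + m * a ≡ + 0 [mod m ]
    multiple≡0-mod a = mod (divides a (multiple-difference (+ m) a))

    ≡-mod-dec : ∀ a b → Dec (a ≡ b [mod m ])
    ≡-mod-dec a b = map′ mod divides-difference (+ m ∣? a - b)

  *-mono-mod : ∀ d {m a b} → a ≡ b [mod m ] → + d * a ≡ + d * b [mod d ℕ.* m ]
  *-mono-mod d {m} {a} {b} (mod p) =
    mod (subst₂ _∣_ (sym (ℤ.pos-* d m)) (sym (scaled-difference (+ d) a b)) (*-monoʳ-∣ (+ d) p))

  *-cancel-mod : ∀ d .{{_ : NonZero d}} {m a b} →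
    + d * a ≡ + d * b [mod d ℕ.* m ] → a ≡ b [mod m ]
  *-cancel-mod d {m} {a} {b} (mod p) =
    mod (*-cancelˡ-∣ (+ d) (subst₂ _∣_ (ℤ.pos-* d m) (scaled-difference (+ d) a b) p))

  ≡-mod-weaken : ∀ d {m a b} → a ≡ b [mod d ℕ.* m ] → a ≡ b [mod m ]
  ≡-mod-weaken d {m} (mod p) = mod (∣-trans (divides (+ d) (ℤ.pos-* d m)) p)

  ≡ω⇒≡-mod : ∀ {e} {a b : Zω e} {n} → a ≡ω b [mod2^ n ] → ∀ k → a k ≡ b k [mod 2 ℕ.^ n ]
  ≡ω⇒≡-mod a≡b k = mod (∣ᵤ⇒∣ (a≡b k))

  +-commutativeMonoid-mod : ℕ → CommutativeMonoid 0ℓ 0ℓ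
  +-commutativeMonoid-mod m = record
    { Carrier = ℤ
    ; _≈_ = _≡_[mod m ]
    ; _∙_ = _+_
    ; ε = + 0
    ; isCommutativeMonoid = record
      { isMonoid = record
        { isSemigroup = record
          { isMagma = record { isEquivalence = ≡-mod-isEquivalence ; ∙-cong = +-cong-mod }
          ; assoc = λ a b c → ≡⇒≡-mod (ℤ.+-assoc a b c)
          }
        ; identity = (λ a → ≡⇒≡-mod (ℤ.+-identityˡ a)) , (λ a → ≡⇒≡-mod (ℤ.+-identityʳ a))
        }
      ; comm = λ a b → ≡⇒≡-mod (ℤ.+-comm a b)
      }
    }

  module ≡-mod-Reasoning (m : ℕ) = ≈-Reasoning (CommutativeMonoid.setoid (+-commutativeMonoid-mod m))

  module _ (m : ℕ) .{{_ : NonZero m}} where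

    residue : ∀ a → ∃[ r ] a ≡ + toℕ {m} r [mod m ]
    residue a = fromℕ< r<m , mod (divides (a /ℕ m) (begin
      a - + toℕ (fromℕ< r<m) ≡⟨ cong (λ r → a - + r) (toℕ-fromℕ< r<m) ⟩
      a - + (a %ℕ m)         ≡⟨ cong (_- + (a %ℕ m)) (a≡a%ℕn+[a/ℕn]*n a m) ⟩
      + (a %ℕ m) + (a /ℕ m) * + m - + (a %ℕ m) ≡⟨ add-subtract-cancel (+ (a %ℕ m)) _ ⟩
      (a /ℕ m) * + m         ∎))
      where
      open ≡-Reasoning
      r<m = n%ℕd<d a m

    on-residues³ : (P : ℤ → ℤ → ℤ → Set) →
      (∀ {a b c a′ b′ c′} → a ≡ a′ [mod m ] → b ≡ b′ [mod m ] → c ≡ c′ [mod m ] →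
        P a′ b′ c′ → P a b c) →
      (P? : ∀ a b c → Dec (P a b c)) →
      {True (all? λ (r : Fin m) → all? λ s → all? λ t → P? (+ toℕ r) (+ toℕ s) (+ toℕ t))} →
      ∀ a b c → P a b c
    on-residues³ P respects P? {holds} a b c with residue a | residue b | residue c
    ... | r , a≡r | s , b≡s | t , c≡t = respects a≡r b≡s c≡t (toWitness holds r s t)

  square≡self-mod2 : ∀ a → a * a ≡ a [mod 2 ]
  square≡self-mod2 a with residue 2 a
  ... | r , a≡r = ≡-mod-trans (*-cong-mod a≡r a≡r) (≡-mod-trans (idempotent r) (≡-mod-sym a≡r))
    where
    idempotent : ∀ (r : Fin 2) → + toℕ r * + toℕ r ≡ + toℕ r [mod 2 ]
    idempotent 0F = ≡-mod-refl
    idempotent 1F = ≡-mod-refl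

  +-2*even-mod4 : ∀ a {t} → t ≡ + 0 [mod 2 ] → a + + 2 * t ≡ a [mod 4 ]
  +-2*even-mod4 a t≡0 =
    ≡-mod-trans (+-cong-mod (≡-mod-refl {a = a}) (*-mono-mod 2 t≡0)) (≡⇒≡-mod (ℤ.+-identityʳ a))

  odd*≡square-mod2 : ∀ {a} b → a ≡ + 1 [mod 2 ] → a * b ≡ b * b [mod 2 ]
  odd*≡square-mod2 b a≡1 = ≡-mod-trans (*-cong-mod a≡1 (≡-mod-refl {a = b}))
    (≡-mod-trans (≡⇒≡-mod (ℤ.*-identityˡ b)) (≡-mod-sym (square≡self-mod2 b)))

  sumOfSquares : ℤ → ℤ → ℤ → ℤ
  sumOfSquares a b c = a * a + b * b + c * c

  sumOfSquares-cong : ∀ {m a b c a′ b′ c′} →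
    a ≡ a′ [mod m ] → b ≡ b′ [mod m ] → c ≡ c′ [mod m ] →
    sumOfSquares a b c ≡ sumOfSquares a′ b′ c′ [mod m ]
  sumOfSquares-cong a≡ b≡ c≡ =
    +-cong-mod (+-cong-mod (*-cong-mod a≡ a≡) (*-cong-mod b≡ b≡)) (*-cong-mod c≡ c≡)

  sumOfSquares≢7-mod8 : ∀ a b c → ¬ sumOfSquares a b c ≡ + 7 [mod 8 ]
  sumOfSquares≢7-mod8 = on-residues³ 8 (λ a b c → ¬ sumOfSquares a b c ≡ + 7 [mod 8 ])
    (λ a≡ b≡ c≡ ≢7 ≡7 → ≢7 (≡-mod-trans (≡-mod-sym (sumOfSquares-cong a≡ b≡ c≡)) ≡7))
    (λ a b c → ¬? (≡-mod-dec (sumOfSquares a b c) (+ 7)))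

  private
    module SquaresForceParity (s p : ℤ) where

      P : ℤ → ℤ → ℤ → Set
      P a b c = sumOfSquares a b c ≡ s [mod 4 ] → a ≡ p [mod 2 ] × b ≡ p [mod 2 ] × c ≡ p [mod 2 ]

      respects : ∀ {a b c a′ b′ c′} → a ≡ a′ [mod 4 ] → b ≡ b′ [mod 4 ] → c ≡ c′ [mod 4 ] →
        P a′ b′ c′ → P a b c
      respects a≡ b≡ c≡ implies ≡s = map (lift a≡) (map (lift b≡) (lift c≡))
        (implies (≡-mod-trans (≡-mod-sym (sumOfSquares-cong a≡ b≡ c≡)) ≡s))
        where
        lift : ∀ {a a′} → a ≡ a′ [mod 4 ] → a′ ≡ p [mod 2 ] → a ≡ p [mod 2 ]
        lift a≡ = ≡-mod-trans (≡-mod-weaken 2 a≡)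

      P? : ∀ a b c → Dec (P a b c)
      P? a b c = ≡-mod-dec _ s →-dec (≡-mod-dec a p ×-dec ≡-mod-dec b p ×-dec ≡-mod-dec c p)

  sumOfSquares≡3⇒odd : ∀ a b c → sumOfSquares a b c ≡ + 3 [mod 4 ] →
    a ≡ + 1 [mod 2 ] × b ≡ + 1 [mod 2 ] × c ≡ + 1 [mod 2 ]
  sumOfSquares≡3⇒odd = on-residues³ 4 P respects P?
    where open SquaresForceParity (+ 3) (+ 1)

  sumOfSquares≡0⇒even : ∀ a b c → sumOfSquares a b c ≡ + 0 [mod 4 ] →
    a ≡ + 0 [mod 2 ] × b ≡ + 0 [mod 2 ] × c ≡ + 0 [mod 2 ]
  sumOfSquares≡0⇒even = on-residues³ 4 P respects P?
    where open SquaresForceParity (+ 0) (+ 0)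

  module _ {c ℓ} (M : CommutativeMonoid c ℓ) where

    open CommutativeMonoid M
      using (Carrier; _≈_; setoid; ∙-congˡ; identityʳ) renaming (_∙_ to _⊕_; ε to 0#)
    open ≈-Reasoning setoid
    open Sum M using (sum; sum-cong-≋; sum-replicate-zero; sum-remove)

    sum-zero : ∀ {n} (f : Vector Carrier n) → (∀ i → f i ≈ 0#) → sum f ≈ 0#
    sum-zero {n} f f≈0 = begin
      sum f                ≈⟨ sum-cong-≋ f≈0 ⟩
      sum (replicate n 0#) ≈⟨ sum-replicate-zero n ⟩
      0#                   ∎

    sum-single : ∀ {n} (f : Vector Carrier n) i → (∀ j → j ≢ i → f j ≈ 0#) → sum f ≈ f i
    sum-single {suc n} f i others≈0 = begin
      sum f                          ≈⟨ sum-remove {i = i} f ⟩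
      f i ⊕ sum (removeAt f i)       ≈⟨ ∙-congˡ (sum-zero _ (λ j → others≈0 _ (punchInᵢ≢i i j))) ⟩
      f i ⊕ 0#                       ≈⟨ identityʳ (f i) ⟩
      f i                            ∎

  open Sum ℤ.+-0-commutativeMonoid using (sum; sum-cong-≗; ∑-distrib-+)

  sumFin≡sum : ∀ {n} (f : Fin n → ℤ) → sumFin f ≡ sum f
  sumFin≡sum {zero} f = refl
  sumFin≡sum {suc n} f = cong (λ s → f zero + s) (sumFin≡sum (λ i → f (suc i)))

  sumUpper : ∀ {n} → (Fin n → Fin n → ℤ) → ℤ
  sumUpper {zero}  g = + 0
  sumUpper {suc n} g = sum (λ j → g zero (suc j)) + sumUpper (λ i j → g (suc i) (suc j))

  private
    regroup : ∀ a r d u → (a + r) + (r + (d + + 2 * u)) ≡ (a + d) + + 2 * (r + u)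
    regroup = solve-∀

  sum²-symmetric : ∀ {n} (g : Fin n → Fin n → ℤ) → (∀ i j → g i j ≡ g j i) →
    sum (λ i → sum (g i)) ≡ sum (λ i → g i i) + + 2 * sumUpper g
  sum²-symmetric {zero}  g g-sym = refl
  sum²-symmetric {suc n} g g-sym = begin
    (g zero zero + row) + sum (λ i → g (suc i) zero + sum (g′ i))
      ≡⟨ cong (λ s → (g zero zero + row) + s) (∑-distrib-+ (λ i → g (suc i) zero) (sum ∘ g′)) ⟩
    (g zero zero + row) + (sum (λ i → g (suc i) zero) + sum (λ i → sum (g′ i)))
      ≡⟨ cong₂ (λ s t → (g zero zero + row) + (s + t))
           (sum-cong-≗ (λ i → g-sym (suc i) zero))
           (sum²-symmetric g′ (λ i j → g-sym (suc i) (suc j))) ⟩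
    (g zero zero + row) + (row + (sum (λ i → g′ i i) + + 2 * sumUpper g′))
      ≡⟨ regroup (g zero zero) row (sum (λ i → g′ i i)) (sumUpper g′) ⟩
    (g zero zero + sum (λ i → g′ i i)) + + 2 * (row + sumUpper g′) ∎
    where
    open ≡-Reasoning
    g′ : Fin n → Fin n → ℤ
    g′ i j = g (suc i) (suc j)
    row : ℤ
    row = sum (λ j → g zero (suc j))

  sumUpper-zero : ∀ {m n} {g : Fin n → Fin n → ℤ} →
    (∀ i j → i Fin.< j → g i j ≡ + 0 [mod m ]) → sumUpper g ≡ + 0 [mod m ]
  sumUpper-zero {m} {zero}  upper≡0 = ≡-mod-refl
  sumUpper-zero {m} {suc n} upper≡0 = +-cong-mod
    (sum-zero (+-commutativeMonoid-mod m) _ (λ j → upper≡0 zero (suc j) ℕ.z<s))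
    (sumUpper-zero (λ i j i<j → upper≡0 (suc i) (suc j) (ℕ.s<s i<j)))

  sumUpper-single : ∀ {m n} {g : Fin n → Fin n → ℤ} {i₀ j₀} → i₀ Fin.< j₀ →
    (∀ i j → i Fin.< j → (i , j) ≢ (i₀ , j₀) → g i j ≡ + 0 [mod m ]) →
    sumUpper g ≡ g i₀ j₀ [mod m ]
  sumUpper-single {m} {suc n} {g} {zero} {suc j₀} _ others≡0 =
    ≡-mod-trans (+-cong-mod first-row≡ rest≡0) (≡⇒≡-mod (ℤ.+-identityʳ _))
    where
    first-row≡ : sum (λ j → g zero (suc j)) ≡ g zero (suc j₀) [mod m ]
    first-row≡ = sum-single (+-commutativeMonoid-mod m) _ j₀
      (λ j j≢j₀ → others≡0 zero (suc j) ℕ.z<s (λ eq → j≢j₀ (Fin.suc-injective (cong proj₂ eq))))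
    rest≡0 : sumUpper (λ i j → g (suc i) (suc j)) ≡ + 0 [mod m ]
    rest≡0 = sumUpper-zero (λ i j i<j →
      others≡0 (suc i) (suc j) (ℕ.s<s i<j) (λ eq → 0≢1+n (sym (cong proj₁ eq))))
  sumUpper-single {m} {suc n} {g} {suc i₀} {suc j₀} (ℕ.s≤s i₀<j₀) others≡0 =
    ≡-mod-trans (+-cong-mod first-row≡0 rest≡) (≡⇒≡-mod (ℤ.+-identityˡ _))
    where
    first-row≡0 : sum (λ j → g zero (suc j)) ≡ + 0 [mod m ]
    first-row≡0 = sum-zero (+-commutativeMonoid-mod m) _
      (λ j → others≡0 zero (suc j) ℕ.z<s (λ eq → 0≢1+n (cong proj₁ eq)))
    rest≡ : sumUpper (λ i j → g (suc i) (suc j)) ≡ g (suc i₀) (suc j₀) [mod m ]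
    rest≡ = sumUpper-single i₀<j₀ (λ i j i<j i,j≢ → others≡0 (suc i) (suc j) (ℕ.s<s i<j)
      (λ eq → i,j≢ (cong₂ _,_ (Fin.suc-injective (cong proj₁ eq))
                               (Fin.suc-injective (cong proj₂ eq)))))

  double-injective : ∀ {m n} → m ℕ.+ m ≡ n ℕ.+ n → m ≡ n
  double-injective {m} {n} eq =
    trans (ℕ.n≡⌊n+n/2⌋ m) (trans (cong ℕ.⌊_/2⌋ eq) (sym (ℕ.n≡⌊n+n/2⌋ n)))

  double≢suc-double : ∀ m n → m ℕ.+ m ≢ suc (n ℕ.+ n)
  double≢suc-double (suc m) n eq =
    double≢suc-double n m (sym (trans (sym (ℕ.+-suc m m)) (ℕ.suc-injective eq)))

  half-< : ∀ {m n} → m ℕ.+ m ℕ.< n ℕ.+ n → m ℕ.< n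
  half-< m+m<n+n = ℕ.≰⇒> (λ n≤m → ℕ.<⇒≱ m+m<n+n (ℕ.+-mono-≤ n≤m n≤m))

  private
    double+odd : ∀ m h → (m ℕ.+ m) ℕ.+ suc (2 ℕ.* h) ≡ suc ((m ℕ.+ h) ℕ.+ (m ℕ.+ h))
    double+odd = ℕ-solve-∀
    odd+odd : ∀ d h → suc (d ℕ.+ d) ℕ.+ suc (2 ℕ.* h) ≡ (suc h ℕ.+ d) ℕ.+ (suc h ℕ.+ d)
    odd+odd = ℕ-solve-∀

  <⇒+≢0 : ∀ {m n} → m ℕ.< n → m ℕ.+ n ≢ 0
  <⇒+≢0 {m} m<n m+n≡0 = ℕ.n≮0 (subst (m ℕ.<_) (ℕ.m+n≡0⇒n≡0 m m+n≡0) m<n)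

  smaller-half : ∀ {i j L} → i ℕ.< j → i ℕ.+ j ℕ.≤ L ℕ.+ L → i ℕ.< L
  smaller-half {i} i<j i+j≤L+L = half-< (ℕ.<-≤-trans (ℕ.+-monoʳ-< i i<j) i+j≤L+L)

  index-of : ∀ {n k} (P : ℕ → Set) → k ℕ.< n → P k → ∃[ i ] P (toℕ {n} i)
  index-of P k<n pk = fromℕ< k<n , subst P (sym (toℕ-fromℕ< k<n)) pk

  module SquareCoefficients (h : ℕ) where

    e : ℕ
    e = suc (2 ℕ.* h)

    e≡suc[h+h] : e ≡ suc (h ℕ.+ h)
    e≡suc[h+h] = cong (λ n → suc (h ℕ.+ n)) (ℕ.+-identityʳ h)

    h+h<e : h ℕ.+ h ℕ.< e
    h+h<e = subst (h ℕ.+ h ℕ.<_) (sym e≡suc[h+h]) (ℕ.n<1+n (h ℕ.+ h))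

    coeff : Zω e → ℕ → ℤ
    coeff X n with n ℕ.<? e
    ... | yes n<e = X (fromℕ< n<e)
    ... | no  _   = + 0

    coeff-fromℕ< : ∀ X {n} (n<e : n ℕ.< e) → coeff X n ≡ X (fromℕ< n<e)
    coeff-fromℕ< X {n} n<e with n ℕ.<? e
    ... | yes _   = refl
    ... | no  n≮e = contradiction n<e n≮e

    coeff-toℕ : ∀ X i → coeff X (toℕ i) ≡ X i
    coeff-toℕ X i = trans (coeff-fromℕ< X (Fin.toℕ<n i)) (cong X (Fin.fromℕ<-toℕ i _))

    squareTerm : Zω e → Fin e → Fin e → Fin e → ℤ
    squareTerm X k i j =
      if ⌊ toℕ i ℕ.+ toℕ j ℕ.≟ toℕ k ⌋ then X i * X j
      else (if ⌊ toℕ i ℕ.+ toℕ j ℕ.≟ toℕ k ℕ.+ e ⌋ then + 2 * (X i * X j)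
      else + 0)

    squareTerm-sym : ∀ X k i j → squareTerm X k i j ≡ squareTerm X k j i
    squareTerm-sym X k i j rewrite ℕ.+-comm (toℕ i) (toℕ j) | ℤ.*-comm (X i) (X j) = refl

    squareTerm-direct : ∀ X k i j → toℕ i ℕ.+ toℕ j ≡ toℕ k → squareTerm X k i j ≡ X i * X j
    squareTerm-direct X k i j i+j≡k with toℕ i ℕ.+ toℕ j ℕ.≟ toℕ k
    ... | yes _      = refl
    ... | no  i+j≢k  = contradiction i+j≡k i+j≢k

    squareTerm-wrapped : ∀ X k i j → toℕ i ℕ.+ toℕ j ≡ toℕ k ℕ.+ e →
      squareTerm X k i j ≡ + 2 * (X i * X j)
    squareTerm-wrapped X k i j i+j≡k+e
      with toℕ i ℕ.+ toℕ j ℕ.≟ toℕ k | toℕ i ℕ.+ toℕ j ℕ.≟ toℕ k ℕ.+ e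
    ... | yes i+j≡k | _             = contradiction (trans (sym i+j≡k+e) i+j≡k) (ℕ.m+1+n≢m (toℕ k))
    ... | no  _     | yes _         = refl
    ... | no  _     | no i+j≢k+e    = contradiction i+j≡k+e i+j≢k+e

    squareTerm-none : ∀ X k i j →
      toℕ i ℕ.+ toℕ j ≢ toℕ k → toℕ i ℕ.+ toℕ j ≢ toℕ k ℕ.+ e →
      squareTerm X k i j ≡ + 0
    squareTerm-none X k i j i+j≢k i+j≢k+e
      with toℕ i ℕ.+ toℕ j ℕ.≟ toℕ k | toℕ i ℕ.+ toℕ j ℕ.≟ toℕ k ℕ.+ e
    ... | yes i+j≡k | _           = contradiction i+j≡k i+j≢k
    ... | no  _     | yes i+j≡k+e = contradiction i+j≡k+e i+j≢k+e
    ... | no  _     | no  _       = refl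

    squareTerm-even : ∀ X k i j → toℕ i ℕ.+ toℕ j ≢ toℕ k → squareTerm X k i j ≡ + 0 [mod 2 ]
    squareTerm-even X k i j i+j≢k
      with toℕ i ℕ.+ toℕ j ℕ.≟ toℕ k | toℕ i ℕ.+ toℕ j ℕ.≟ toℕ k ℕ.+ e
    ... | yes i+j≡k | _     = contradiction i+j≡k i+j≢k
    ... | no  _     | yes _ = multiple≡0-mod (X i * X j)
    ... | no  _     | no  _ = ≡-mod-refl

    diagonal : Zω e → Fin e → ℤ
    diagonal X k = sum (λ i → squareTerm X k i i)

    square-coefficient : ∀ X k → (X *ω X) k ≡ diagonal X k + + 2 * sumUpper (squareTerm X k)
    square-coefficient X k = begin
      (X *ω X) k                                      ≡⟨ sumFin≡sum (sumFin ∘ squareTerm X k) ⟩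
      sum (λ i → sumFin (squareTerm X k i))           ≡⟨ sum-cong-≗ (sumFin≡sum ∘ squareTerm X k) ⟩
      sum (λ i → sum (squareTerm X k i))              ≡⟨ sum²-symmetric _ (squareTerm-sym X k) ⟩
      diagonal X k + + 2 * sumUpper (squareTerm X k)  ∎
      where open ≡-Reasoning

    diagonal-even : ∀ X k m → toℕ k ≡ m ℕ.+ m → diagonal X k ≡ coeff X m * coeff X m
    diagonal-even X k m k≡m+m = begin
      diagonal X k           ≡⟨ sum-single ℤ.+-0-commutativeMonoid _ i₀ others≡0 ⟩
      squareTerm X k i₀ i₀   ≡⟨ squareTerm-direct X k i₀ i₀ (trans i₀+i₀≡m+m (sym k≡m+m)) ⟩
      X i₀ * X i₀            ≡⟨ cong (λ x → x * x) (coeff-fromℕ< X m<e) ⟨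
      coeff X m * coeff X m  ∎
      where
      open ≡-Reasoning
      m<e : m ℕ.< e
      m<e = ℕ.≤-<-trans (ℕ.m≤m+n m m) (subst (ℕ._< e) k≡m+m (Fin.toℕ<n k))
      i₀ = fromℕ< m<e
      i₀≡m : toℕ i₀ ≡ m
      i₀≡m = toℕ-fromℕ< m<e
      i₀+i₀≡m+m = cong₂ ℕ._+_ i₀≡m i₀≡m
      others≡0 : ∀ i → i ≢ i₀ → squareTerm X k i i ≡ + 0
      others≡0 i i≢i₀ = squareTerm-none X k i i
        (λ i+i≡k → i≢i₀ (Fin.toℕ-injective
          (trans (double-injective (trans i+i≡k k≡m+m)) (sym i₀≡m))))
        (λ i+i≡k+e → double≢suc-double (toℕ i) (m ℕ.+ h)
          (trans i+i≡k+e (trans (cong (ℕ._+ e) k≡m+m) (double+odd m h))))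

    diagonal-odd : ∀ X k M → toℕ k ℕ.+ e ≡ M ℕ.+ M → diagonal X k ≡ + 2 * (coeff X M * coeff X M)
    diagonal-odd X k M k+e≡M+M = begin
      diagonal X k                   ≡⟨ sum-single ℤ.+-0-commutativeMonoid _ i₀ others≡0 ⟩
      squareTerm X k i₀ i₀           ≡⟨ squareTerm-wrapped X k i₀ i₀ (trans i₀+i₀≡M+M (sym k+e≡M+M)) ⟩
      + 2 * (X i₀ * X i₀)            ≡⟨ cong (λ x → + 2 * (x * x)) (coeff-fromℕ< X M<e) ⟨
      + 2 * (coeff X M * coeff X M)  ∎
      where
      open ≡-Reasoning
      M<e : M ℕ.< e
      M<e = half-< (subst (ℕ._< e ℕ.+ e) k+e≡M+M (ℕ.+-monoˡ-< e (Fin.toℕ<n k)))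
      i₀ = fromℕ< M<e
      i₀≡M : toℕ i₀ ≡ M
      i₀≡M = toℕ-fromℕ< M<e
      i₀+i₀≡M+M = cong₂ ℕ._+_ i₀≡M i₀≡M
      others≡0 : ∀ i → i ≢ i₀ → squareTerm X k i i ≡ + 0
      others≡0 i i≢i₀ = squareTerm-none X k i i
        (λ i+i≡k → double≢suc-double M (toℕ i ℕ.+ h)
          (trans (sym k+e≡M+M) (trans (cong (ℕ._+ e) (sym i+i≡k)) (double+odd (toℕ i) h))))
        (λ i+i≡k+e → i≢i₀ (Fin.toℕ-injective
          (trans (double-injective (trans i+i≡k+e k+e≡M+M)) (sym i₀≡M))))

    EvenBelow : Zω e → ℕ → Set
    EvenBelow X L = ∀ n → 0 ℕ.< n → n ℕ.< L → coeff X n ≡ + 0 [mod 2 ]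

    even-term : ∀ X {L} → EvenBelow X L → ∀ i j → 0 ℕ.< toℕ i → toℕ i ℕ.< L →
      X i * X j ≡ + 0 [mod 2 ]
    even-term X even i j 0<i i<L =
      *-cong-mod (subst (_≡ + 0 [mod 2 ]) (coeff-toℕ X i) (even (toℕ i) 0<i i<L)) (≡-mod-refl {a = X j})

    sumUpper₀≡0-mod2 : ∀ X → sumUpper (squareTerm X zero) ≡ + 0 [mod 2 ]
    sumUpper₀≡0-mod2 X = sumUpper-zero (λ i j i<j → squareTerm-even X zero i j (<⇒+≢0 i<j))

    sumUpper₀≡0-mod4 : ∀ X → EvenBelow X (suc h) → sumUpper (squareTerm X zero) ≡ + 0 [mod 4 ]
    sumUpper₀≡0-mod4 X even = sumUpper-zero term≡0
      where
      term≡0 : ∀ i j → i Fin.< j → squareTerm X zero i j ≡ + 0 [mod 4 ]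
      term≡0 i j i<j = case toℕ i ℕ.+ toℕ j ℕ.≟ e of λ where
          (no  i+j≢e) → ≡⇒≡-mod (squareTerm-none X zero i j (<⇒+≢0 i<j) i+j≢e)
          (yes i+j≡e) → ≡-mod-trans (≡⇒≡-mod (squareTerm-wrapped X zero i j i+j≡e))
            (*-mono-mod 2 (even-term X even i j (positive i j i+j≡e) (i≤h i<j i+j≡e)))
        where
        positive : ∀ i j → toℕ i ℕ.+ toℕ j ≡ e → 0 ℕ.< toℕ i
        positive zero    j j≡e = contradiction j≡e (ℕ.<⇒≢ (Fin.toℕ<n j))
        positive (suc _) _ _   = ℕ.z<s
        i≤h : ∀ {i j : Fin e} → i Fin.< j → toℕ i ℕ.+ toℕ j ≡ e → toℕ i ℕ.< suc h
        i≤h i<j i+j≡e = smaller-half i<j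
          (ℕ.≤-trans (ℕ.≤-reflexive (trans i+j≡e e≡suc[h+h])) (ℕ.+-monoʳ-≤ (suc h) (ℕ.n≤1+n h)))

    sumUpper≡x₀xₖ-mod2 : ∀ X k L → 0 ℕ.< toℕ k → toℕ k ℕ.≤ L ℕ.+ L → EvenBelow X L →
      sumUpper (squareTerm X k) ≡ X zero * X k [mod 2 ]
    sumUpper≡x₀xₖ-mod2 X k L 0<k k≤L+L even =
      ≡-mod-trans (sumUpper-single 0<k others≡0) (≡⇒≡-mod (squareTerm-direct X k zero k refl))
      where
      others≡0 : ∀ i j → i Fin.< j → (i , j) ≢ (zero , k) → squareTerm X k i j ≡ + 0 [mod 2 ]
      others≡0 i j i<j i,j≢0,k = case toℕ i ℕ.+ toℕ j ℕ.≟ toℕ k of λ where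
          (no  i+j≢k) → squareTerm-even X k i j i+j≢k
          (yes i+j≡k) → ≡-mod-trans (≡⇒≡-mod (squareTerm-direct X k i j i+j≡k))
            (even-term X even i j (positive i j i,j≢0,k i+j≡k)
              (smaller-half i<j (ℕ.≤-trans (ℕ.≤-reflexive i+j≡k) k≤L+L)))
        where
        positive : ∀ i j → (i , j) ≢ (zero , k) → toℕ i ℕ.+ toℕ j ≡ toℕ k → 0 ℕ.< toℕ i
        positive zero j i,j≢0,k j≡k = contradiction (cong (zero ,_) (Fin.toℕ-injective j≡k)) i,j≢0,k
        positive (suc _) _ _ _ = ℕ.z<s

    square-coefficient-mod : ∀ {m} X k {c} → sumUpper (squareTerm X k) ≡ c [mod m ] →
      (X *ω X) k ≡ diagonal X k + + 2 * c [mod 2 ℕ.* m ]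
    square-coefficient-mod X k upper≡c =
      ≡-mod-trans (≡⇒≡-mod (square-coefficient X k))
                  (+-cong-mod (≡-mod-refl {a = diagonal X k}) (*-mono-mod 2 upper≡c))

    square≡diagonal-mod2 : ∀ X k → (X *ω X) k ≡ diagonal X k [mod 2 ]
    square≡diagonal-mod2 X k = ≡-mod-trans (≡⇒≡-mod (square-coefficient X k))
      (≡-mod-trans (+-cong-mod (≡-mod-refl {a = diagonal X k}) (multiple≡0-mod _))
                   (≡⇒≡-mod (ℤ.+-identityʳ _)))

    square₀≡x₀²-mod4 : ∀ X → (X *ω X) zero ≡ X zero * X zero [mod 4 ]
    square₀≡x₀²-mod4 X = ≡-mod-trans (square-coefficient-mod X zero (sumUpper₀≡0-mod2 X))
      (≡⇒≡-mod (trans (ℤ.+-identityʳ _) (diagonal-even X zero 0 refl)))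

    square₀≡x₀²-mod8 : ∀ X → EvenBelow X (suc h) → (X *ω X) zero ≡ X zero * X zero [mod 8 ]
    square₀≡x₀²-mod8 X even = ≡-mod-trans (square-coefficient-mod X zero (sumUpper₀≡0-mod4 X even))
      (≡⇒≡-mod (trans (ℤ.+-identityʳ _) (diagonal-even X zero 0 refl)))

    square≡diagonal+2x₀xₖ-mod4 : ∀ X k L →
      0 ℕ.< toℕ k → toℕ k ℕ.≤ L ℕ.+ L → EvenBelow X L →
      (X *ω X) k ≡ diagonal X k + + 2 * (coeff X 0 * coeff X (toℕ k)) [mod 4 ]
    square≡diagonal+2x₀xₖ-mod4 X k L 0<k k≤L+L even =
      subst (λ xₖ → (X *ω X) k ≡ diagonal X k + + 2 * (X zero * xₖ) [mod 4 ]) (sym (coeff-toℕ X k))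
            (square-coefficient-mod X k (sumUpper≡x₀xₖ-mod2 X k L 0<k k≤L+L even))

    square≡coeff²-mod2 : ∀ X k m → toℕ k ≡ m ℕ.+ m → (X *ω X) k ≡ coeff X m * coeff X m [mod 2 ]
    square≡coeff²-mod2 X k m k≡m+m =
      ≡-mod-trans (square≡diagonal-mod2 X k) (≡⇒≡-mod (diagonal-even X k m k≡m+m))

    double-index : ∀ {m} → m ℕ.≤ h → ∃[ k ] toℕ {e} k ≡ m ℕ.+ m
    double-index {m} m≤h =
      index-of (λ k → k ≡ m ℕ.+ m) (ℕ.≤-<-trans (ℕ.+-mono-≤ m≤h m≤h) h+h<e) refl

    wrapped-index : ∀ {n} → h ℕ.< n → n ℕ.≤ h ℕ.+ h →
      ∃[ k ] 0 ℕ.< toℕ {e} k × toℕ k ℕ.< n × toℕ k ℕ.+ e ≡ n ℕ.+ n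
    wrapped-index {n} h<n n≤h+h with ℕ.m≤n⇒∃[o]m+o≡n h<n
    ... | d , refl = index-of (λ k → 0 ℕ.< k × k ℕ.< n × k ℕ.+ e ≡ n ℕ.+ n)
                       (ℕ.<-trans k<n (ℕ.≤-<-trans n≤h+h h+h<e)) (ℕ.z<s , k<n , odd+odd d h)
      where
      k<n : suc (d ℕ.+ d) ℕ.< n
      k<n = ℕ.s<s (ℕ.+-monoˡ-< d (ℕ.+-cancelˡ-< h d h n≤h+h))

  private
    collect : ∀ a b c p q r →
      (a + + 2 * p) + (b + + 2 * q) + (c + + 2 * r) ≡ (a + b + c) + + 2 * (p + q + r)
    collect = solve-∀
    twice-sumOfSquares : ∀ a b c →
      + 2 * (a * a) + + 2 * (b * b) + + 2 * (c * c) ≡ + 2 * (a * a + b * b + c * c)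
    twice-sumOfSquares = solve-∀

  module SolutionMod8 (h : ℕ) (X Y Z : Zω (suc (2 ℕ.* h)))
    (≡7 : ∀ k → (X *ω X +ω Y *ω Y +ω Z *ω Z) k ≡ constω (+ 7) k [mod 8 ]) where

    open SquareCoefficients h

    S : Fin e → ℤ
    S = X *ω X +ω Y *ω Y +ω Z *ω Z

    x y z : ℕ → ℤ
    x = coeff X
    y = coeff Y
    z = coeff Z

    W : ℕ → ℤ
    W n = sumOfSquares (x n) (y n) (z n)

    T : ℕ → ℤ
    T n = x 0 * x n + y 0 * y n + z 0 * z n

    D : Fin e → ℤ
    D k = diagonal X k + diagonal Y k + diagonal Z k

    AllEven : ℕ → Set
    AllEven n = x n ≡ + 0 [mod 2 ] × y n ≡ + 0 [mod 2 ] × z n ≡ + 0 [mod 2 ]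

    S≡sum : ∀ {m} k {a b c} →
      (X *ω X) k ≡ a [mod m ] → (Y *ω Y) k ≡ b [mod m ] → (Z *ω Z) k ≡ c [mod m ] →
      S k ≡ a + b + c [mod m ]
    S≡sum k X²≡a Y²≡b Z²≡c = +-cong-mod (+-cong-mod X²≡a Y²≡b) Z²≡c

    S≡0 : ∀ k → 0 ℕ.< toℕ k → S k ≡ + 0 [mod 8 ]
    S≡0 (suc k) _ = ≡7 (suc k)

    constant-odd : x 0 ≡ + 1 [mod 2 ] × y 0 ≡ + 1 [mod 2 ] × z 0 ≡ + 1 [mod 2 ]
    constant-odd = sumOfSquares≡3⇒odd (x 0) (y 0) (z 0) (begin
      W 0     ≈⟨ S≡sum zero (square₀≡x₀²-mod4 X) (square₀≡x₀²-mod4 Y)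
                            (square₀≡x₀²-mod4 Z) ⟨
      S zero  ≈⟨ ≡-mod-weaken 2 (≡7 zero) ⟩
      + 7     ≈⟨ mod (divides (+ 1) refl) ⟩
      + 3     ∎)
      where open ≡-mod-Reasoning 4

    T≡W : ∀ n → T n ≡ W n [mod 2 ]
    T≡W n = +-cong-mod (+-cong-mod (odd*≡square-mod2 (x n) x₀-odd) (odd*≡square-mod2 (y n) y₀-odd))
                       (odd*≡square-mod2 (z n) z₀-odd)
      where
      x₀-odd = proj₁ constant-odd
      y₀-odd = proj₁ (proj₂ constant-odd)
      z₀-odd = proj₂ (proj₂ constant-odd)

    split-evens : ∀ {L} → (∀ n → 0 ℕ.< n → n ℕ.< L → AllEven n) →
      EvenBelow X L × EvenBelow Y L × EvenBelow Z L
    split-evens evens = (λ n 0<n n<L → proj₁ (evens n 0<n n<L))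
                      , (λ n 0<n n<L → proj₁ (proj₂ (evens n 0<n n<L)))
                      , (λ n 0<n n<L → proj₂ (proj₂ (evens n 0<n n<L)))

    W-even≤h : ∀ m → 0 ℕ.< m → m ℕ.≤ h → W m ≡ + 0 [mod 2 ]
    W-even≤h m 0<m m≤h with double-index m≤h
    ... | k , k≡m+m = begin
      W m    ≈⟨ S≡sum k (square≡coeff²-mod2 X k m k≡m+m) (square≡coeff²-mod2 Y k m k≡m+m)
                     (square≡coeff²-mod2 Z k m k≡m+m) ⟨
      S k    ≈⟨ ≡-mod-weaken 4 (S≡0 k 0<k) ⟩
      + 0    ∎
      where
      open ≡-mod-Reasoning 2
      0<k = subst (0 ℕ.<_) (sym k≡m+m) (ℕ.<-≤-trans 0<m (ℕ.m≤m+n m m))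

    module _ (L : ℕ) (L≤h : L ℕ.≤ h) (evenBelow : ∀ n → 0 ℕ.< n → n ℕ.< L → AllEven n) where

      S≡D+2T : ∀ k → 0 ℕ.< toℕ k → toℕ k ℕ.≤ L ℕ.+ L →
        S k ≡ D k + + 2 * T (toℕ k) [mod 4 ]
      S≡D+2T k 0<k k≤L+L = ≡-mod-trans
        (S≡sum k (square≡diagonal+2x₀xₖ-mod4 X k L 0<k k≤L+L evenX)
                 (square≡diagonal+2x₀xₖ-mod4 Y k L 0<k k≤L+L evenY)
                 (square≡diagonal+2x₀xₖ-mod4 Z k L 0<k k≤L+L evenZ))
        (≡⇒≡-mod (collect (diagonal X k) (diagonal Y k) (diagonal Z k)
                          (x 0 * x (toℕ k)) (y 0 * y (toℕ k)) (z 0 * z (toℕ k))))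
        where
        evenX = proj₁ (split-evens evenBelow)
        evenY = proj₁ (proj₂ (split-evens evenBelow))
        evenZ = proj₂ (proj₂ (split-evens evenBelow))

      W-even-wrapped : ∀ n → h ℕ.< n → n ℕ.≤ L ℕ.+ L →
        (∀ {m} → m ℕ.< n → 0 ℕ.< m → m ℕ.≤ L ℕ.+ L → W m ≡ + 0 [mod 2 ]) → W n ≡ + 0 [mod 2 ]
      W-even-wrapped n h<n n≤L+L below
        with wrapped-index h<n (ℕ.≤-trans n≤L+L (ℕ.+-mono-≤ L≤h L≤h))
      ... | k , 0<k , k<n , k+e≡n+n = *-cancel-mod 2 (begin
        + 2 * W n                       ≈⟨ +-2*even-mod4 (+ 2 * W n) Tₖ-even ⟨
        + 2 * W n + + 2 * T (toℕ k)     ≈⟨ ≡⇒≡-mod (cong (λ d → d + + 2 * T (toℕ k)) D≡2W) ⟨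
        D k + + 2 * T (toℕ k)           ≈⟨ S≡D+2T k 0<k k≤L+L ⟨
        S k                             ≈⟨ ≡-mod-weaken 2 (S≡0 k 0<k) ⟩
        + 0                             ∎)
        where
        open ≡-mod-Reasoning 4
        k≤L+L = ℕ.≤-trans (ℕ.<⇒≤ k<n) n≤L+L
        Tₖ-even : T (toℕ k) ≡ + 0 [mod 2 ]
        Tₖ-even = ≡-mod-trans (T≡W (toℕ k)) (below k<n 0<k k≤L+L)
        D≡2W : D k ≡ + 2 * W n
        D≡2W = trans
          (cong₂ _+_ (cong₂ _+_ (diagonal-odd X k n k+e≡n+n) (diagonal-odd Y k n k+e≡n+n))
                     (diagonal-odd Z k n k+e≡n+n))
          (twice-sumOfSquares (x n) (y n) (z n))

      W-even≤2L : ∀ n → 0 ℕ.< n → n ℕ.≤ L ℕ.+ L → W n ≡ + 0 [mod 2 ]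
      W-even≤2L = <-rec _ λ n below 0<n n≤L+L → case n ℕ.≤? h of λ where
        (yes n≤h) → W-even≤h n 0<n n≤h
        (no  n≰h) → W-even-wrapped n (ℕ.≰⇒> n≰h) n≤L+L below

      allEven-step : 0 ℕ.< L → AllEven L
      allEven-step 0<L with double-index L≤h
      ... | k , k≡L+L = sumOfSquares≡0⇒even (x L) (y L) (z L) (begin
        W L                             ≈⟨ +-2*even-mod4 (W L) T₂ₗ-even ⟨
        W L + + 2 * T (toℕ k)           ≈⟨ ≡⇒≡-mod (cong (λ d → d + + 2 * T (toℕ k)) D≡W) ⟨
        D k + + 2 * T (toℕ k)           ≈⟨ S≡D+2T k 0<k (ℕ.≤-reflexive k≡L+L) ⟨
        S k                             ≈⟨ ≡-mod-weaken 2 (S≡0 k 0<k) ⟩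
        + 0                             ∎)
        where
        open ≡-mod-Reasoning 4
        0<k : 0 ℕ.< toℕ k
        0<k = subst (0 ℕ.<_) (sym k≡L+L) (ℕ.<-≤-trans 0<L (ℕ.m≤m+n L L))
        T₂ₗ-even : T (toℕ k) ≡ + 0 [mod 2 ]
        T₂ₗ-even = ≡-mod-trans (T≡W (toℕ k)) (W-even≤2L (toℕ k) 0<k (ℕ.≤-reflexive k≡L+L))
        D≡W : D k ≡ W L
        D≡W = cong₂ _+_ (cong₂ _+_ (diagonal-even X k L k≡L+L) (diagonal-even Y k L k≡L+L))
                        (diagonal-even Z k L k≡L+L)

    allEven : ∀ n → 0 ℕ.< n → n ℕ.≤ h → AllEven n
    allEven = <-rec _ λ n below 0<n n≤h →
      allEven-step n n≤h (λ m 0<m m<n → below m<n 0<m (ℕ.≤-trans (ℕ.<⇒≤ m<n) n≤h)) 0<n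

    impossible : ⊥
    impossible = sumOfSquares≢7-mod8 (x 0) (y 0) (z 0) (begin
      W 0      ≈⟨ S≡sum zero (square₀≡x₀²-mod8 X evenX) (square₀≡x₀²-mod8 Y evenY)
                             (square₀≡x₀²-mod8 Z evenZ) ⟨
      S zero   ≈⟨ ≡7 zero ⟩
      + 7      ∎)
      where
      open ≡-mod-Reasoning 8
      evens = split-evens (λ n 0<n n<1+h → allEven n 0<n (ℕ.≤-pred n<1+h))
      evenX = proj₁ evens
      evenY = proj₁ (proj₂ evens)
      evenZ = proj₂ (proj₂ evens)

open import Data.Nat using (ℕ; suc; _*_)

lemma3p12 : (k : ℕ) → (x y z : ℤ₂[ω] (suc (2 * k)))
    → ¬ SumOfThreeSquaresEq x y z (+ 7)
lemma3p12 k x y z x²+y²+z²≡7 =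
  SolutionMod8.impossible k (at x 3) (at y 3) (at z 3) (≡ω⇒≡-mod {n = 3} (x²+y²+z²≡7 3))
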